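{- Let $T$ be a tree with vertices $v_1,\dots,v_n$, fix $i\le n$, and let $T^{(i)}$ be the directed tree obtained from $T$ by directing every edge away from $v_i$. Define multipliers on the directed edges by $m_{pk}=d_k+1-\sum_{j:(v_k,v_j)\in\delta^+(v_k)}1/m_{kj}$ (computed recursively from the leaves towards $v_i$). Let $(v_p,v_k)$ be a directed edge of $T^{(i)}$ such that $\delta^+(v_k)\neq\emptyset$, and let $m^*=\min\{m_{kj}:(v_k,v_j)\in\delta^+(v_k)\}$. Then \[ m_{pk}\ge \Big(1-\frac{1}{m^*}\Big)d_k+1+\frac{1}{m^*}. \]
   Context: $d_k$ denotes the degree of $v_k$ in $T$; $\delta^+(v_k)$ is the set of outgoing edges $(v_k,v_s)$ of $v_k$ in $T^{(i)}$ (empty sums are $0$). -}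

module Defs where

open import Data.Nat using (ℕ; suc)
open import Data.Integer using (+_)
open import Data.List using (List; []; _∷_; length; foldr)
open import Data.List.Membership.Propositional using (_∈_)
open import Data.Rational using (ℚ; 0ℚ; _+_; _-_; _⊓_; 1/_; ≢-nonZero)
import Data.Rational as Q
open import Data.Rational.Properties using (_≟_)
open import Relation.Nullary using (yes; no)

-- The directed tree T^(i) obtained by
-- orienting every edge of T away from v_i is a rooted tree with root v_i;
-- every node's out-edges delta^+ go to its children.
data RTree : Set where
  node : List RTree → RTree

children : RTree → List RTree
children (node cs) = cs

-- s ⊑ T : s is (the subtree rooted at) a node occurring in T, given by a
-- path from the root of T downward.
data _⊑_ : RTree → RTree → Set where
  root : ∀ {T} → T ⊑ T
  step : ∀ {s c T} → s ⊑ T → c ∈ children s → c ⊑ T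

-- Degree, in the undirected tree T, of the node at a given position:
-- its number of children, plus one for the edge to its parent unless it
-- is the root v_i.
degAt : ∀ {s T} → s ⊑ T → ℕ
degAt {s} root       = length (children s)
degAt {s} (step _ _) = suc (length (children s))

ℕ→ℚ : ℕ → ℚ
ℕ→ℚ n = + n Q./ 1

-- 1/q (multipliers are always >= 2, so the value at 0 is never used)
inv : ℚ → ℚ
inv q with q ≟ 0ℚ
... | yes _  = 0ℚ
... | no q≢0 = 1/_ q {{≢-nonZero q≢0}}

-- Multiplier m_{pk} of the directed edge (v_p, v_k) into the non-root node k
-- (given by its subtree): m_{pk} = d_k + 1 - Σ_{(v_k,v_j) ∈ δ⁺(v_k)} 1/m_{kj},
-- where d_k = (number of children of k) + 1 since k is not the root.
mutual
  mult : RTree → ℚ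
  mult (node cs) = (ℕ→ℚ (suc (length cs)) + ℕ→ℚ 1) - sumInv cs

  sumInv : List RTree → ℚ
  sumInv []       = 0ℚ
  sumInv (c ∷ cs) = inv (mult c) + sumInv cs

minMult : RTree → List RTree → ℚ
minMult c cs = foldr (λ d m → mult d ⊓ m) (mult c) cs

-- Every multiplier is at least 1 (by induction, from the bound below with
-- m = 1), and 1/x is antitone there. So if m ≤ m_kj for every out-edge of v_k,
-- then Σ 1/m_kj ≤ (d_k - 1)/m, and m_pk = d_k + 1 - Σ 1/m_kj rearranges to
-- (1 - 1/m) d_k + 1 + 1/m ≤ m_pk. The corollary is the case m = m*.
module Submission where

open import Defs
open import Data.List using (List; []; _∷_; length)
open import Data.List.Membership.Propositional using (_∈_)
open import Data.List.Relation.Unary.All as All using (All; []; _∷_)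
open import Data.Nat using (ℕ; suc)
open import Data.Nat.Coprimality using (1-coprimeTo)
import Data.Nat.Coprimality as Coprime
open import Data.Integer using (+_)
import Data.Integer as ℤ
import Data.Integer.Properties as ℤ
open import Data.Rational
  using (ℚ; mkℚ; _/_; 0ℚ; 1ℚ; _+_; _-_; _*_; 1/_; _⊓_; _≤_; _≤?_; _<?_; NonZero; NonNegative; Positive; positive)
open import Data.Rational.Properties
open import Data.Rational.Solver using (module +-*-Solver)
open import Relation.Binary.PropositionalEquality using (_≡_; refl; sym; cong; module ≡-Reasoning)
open import Relation.Nullary using (yes; no; contradiction)
open import Relation.Nullary.Decidable using (toWitness)

open +-*-Solver using (solve; _:=_; con; _:+_; _:*_; _:-_)

ℕ→ℚ-suc : ∀ n → ℕ→ℚ (suc n) ≡ 1ℚ + ℕ→ℚ n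
ℕ→ℚ-suc n = begin
  ℕ→ℚ (suc n)  ≡⟨ cong (λ k → (+ 1 ℤ.+ k) / 1) (ℤ.*-identityʳ (+ n)) ⟨
  1ℚ + n/1     ≡⟨ cong (λ q → 1ℚ + q) (↥p/↧p≡p n/1) ⟨
  1ℚ + ℕ→ℚ n   ∎
  where
  open ≡-Reasoning
  n/1 : ℚ
  n/1 = mkℚ (+ n) 0 (Coprime.sym (1-coprimeTo n))

1≤⇒positive : ∀ {a} → 1ℚ ≤ a → Positive a
1≤⇒positive 1≤a = positive (<-≤-trans (toWitness {a? = 0ℚ <? 1ℚ} _) 1≤a)

inv-positive : ∀ a .{{_ : Positive a}} → inv a ≡ (1/ a) {{pos⇒nonZero a}}
inv-positive a with a ≟ 0ℚ
... | yes refl = contradiction refl (<⇒≢ (positive⁻¹ a))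
... | no _     = refl

inv-antimono-≤ : ∀ {a b} → 1ℚ ≤ a → a ≤ b → inv b ≤ inv a
inv-antimono-≤ {a} {b} 1≤a a≤b = begin
  inv b                  ≡⟨ inv-positive b ⟩
  1/ b                   ≡⟨ *-identityˡ (1/ b) ⟨
  1ℚ * 1/ b              ≡⟨ cong (_* 1/ b) (*-inverseˡ a) ⟨
  (1/ a * a) * 1/ b      ≤⟨ *-monoʳ-≤-nonNeg (1/ b) (*-monoˡ-≤-nonNeg (1/ a) a≤b) ⟩
  (1/ a * b) * 1/ b      ≡⟨ *-assoc (1/ a) b (1/ b) ⟩
  1/ a * (b * 1/ b)      ≡⟨ cong (λ x → 1/ a * x) (*-inverseʳ b) ⟩
  1/ a * 1ℚ              ≡⟨ *-identityʳ (1/ a) ⟩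
  1/ a                   ≡⟨ inv-positive a ⟨
  inv a                  ∎
  where
  open ≤-Reasoning
  instance
    a>0 : Positive a
    a>0 = 1≤⇒positive 1≤a
    b>0 : Positive b
    b>0 = 1≤⇒positive (≤-trans 1≤a a≤b)
    a≢0 : NonZero a
    a≢0 = pos⇒nonZero a
    b≢0 : NonZero b
    b≢0 = pos⇒nonZero b
    1/a≥0 : NonNegative (1/ a)
    1/a≥0 = pos⇒nonNeg (1/ a) {{1/pos⇒pos a}}
    1/b≥0 : NonNegative (1/ b)
    1/b≥0 = pos⇒nonNeg (1/ b) {{1/pos⇒pos b}}

sumInv-≤ : ∀ {m} → 1ℚ ≤ m → ∀ {cs} → All (λ c → m ≤ mult c) cs →
           sumInv cs ≤ ℕ→ℚ (length cs) * inv m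
sumInv-≤ {m} 1≤m {[]}     []         = ≤-reflexive (sym (*-zeroˡ (inv m)))
sumInv-≤ {m} 1≤m {c ∷ cs} (m≤c ∷ m≤cs) = begin
  inv (mult c) + sumInv cs   ≤⟨ +-mono-≤ (inv-antimono-≤ 1≤m m≤c) (sumInv-≤ 1≤m m≤cs) ⟩
  inv m + N * inv m          ≡⟨ cong (_+ N * inv m) (*-identityˡ (inv m)) ⟨
  1ℚ * inv m + N * inv m     ≡⟨ *-distribʳ-+ (inv m) 1ℚ N ⟨
  (1ℚ + N) * inv m           ≡⟨ cong (_* inv m) (ℕ→ℚ-suc (length cs)) ⟨
  ℕ→ℚ (suc (length cs)) * inv m ∎
  where
  open ≤-Reasoning
  N : ℚ
  N = ℕ→ℚ (length cs)

mult-lowerBound : ∀ {m} → 1ℚ ≤ m → ∀ {cs} → All (λ c → m ≤ mult c) cs →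
                  (1ℚ - inv m) * ℕ→ℚ (suc (length cs)) + 1ℚ + inv m ≤ mult (node cs)
mult-lowerBound {m} 1≤m {cs} m≤cs = begin
  (1ℚ - inv m) * ℕ→ℚ (suc n) + 1ℚ + inv m   ≡⟨ cong (λ d → (1ℚ - inv m) * d + 1ℚ + inv m) (ℕ→ℚ-suc n) ⟩
  (1ℚ - inv m) * (1ℚ + ℕ→ℚ n) + 1ℚ + inv m  ≡⟨ rearrange (inv m) (ℕ→ℚ n) ⟩
  ((1ℚ + ℕ→ℚ n) + 1ℚ) - ℕ→ℚ n * inv m      ≡⟨ cong (λ d → (d + 1ℚ) - ℕ→ℚ n * inv m) (ℕ→ℚ-suc n) ⟨
  (ℕ→ℚ (suc n) + 1ℚ) - ℕ→ℚ n * inv m       ≤⟨ +-monoʳ-≤ (ℕ→ℚ (suc n) + 1ℚ) (neg-antimono-≤ (sumInv-≤ 1≤m m≤cs)) ⟩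
  (ℕ→ℚ (suc n) + 1ℚ) - sumInv cs           ∎
  where
  open ≤-Reasoning
  n : ℕ
  n = length cs
  rearrange : ∀ i N → (1ℚ - i) * (1ℚ + N) + 1ℚ + i ≡ ((1ℚ + N) + 1ℚ) - N * i
  rearrange = solve 2 (λ i N → (con 1ℚ :- i) :* (con 1ℚ :+ N) :+ con 1ℚ :+ i
                               := ((con 1ℚ :+ N) :+ con 1ℚ) :- N :* i) refl

mutual
  mult≥1 : ∀ t → 1ℚ ≤ mult t
  mult≥1 (node cs) = begin
    1ℚ                                    ≤⟨ toWitness {a? = 1ℚ ≤? 1ℚ + 1ℚ} _ ⟩
    1ℚ + 1ℚ                               ≡⟨ bound-at-1 d ⟩
    (1ℚ - inv 1ℚ) * d + 1ℚ + inv 1ℚ       ≤⟨ mult-lowerBound ≤-refl (mults≥1 cs) ⟩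
    mult (node cs)                        ∎
    where
    open ≤-Reasoning
    d : ℚ
    d = ℕ→ℚ (suc (length cs))
    bound-at-1 : ∀ x → 1ℚ + 1ℚ ≡ (1ℚ - 1ℚ) * x + 1ℚ + 1ℚ
    bound-at-1 = solve 1 (λ x → con 1ℚ :+ con 1ℚ := (con 1ℚ :- con 1ℚ) :* x :+ con 1ℚ :+ con 1ℚ) refl

  mults≥1 : ∀ cs → All (λ c → 1ℚ ≤ mult c) cs
  mults≥1 []       = []
  mults≥1 (c ∷ cs) = mult≥1 c ∷ mults≥1 cs

minMult-≤ : ∀ c cs → All (λ d → minMult c cs ≤ mult d) (c ∷ cs)
minMult-≤ c []       = ≤-refl ∷ []
minMult-≤ c (d ∷ ds) with minMult-≤ c ds
... | min≤c ∷ min≤ds = ≤-trans ⊓≤min min≤c ∷ p⊓q≤p (mult d) _ ∷ All.map (≤-trans ⊓≤min) min≤ds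
  where
  ⊓≤min : mult d ⊓ minMult c ds ≤ minMult c ds
  ⊓≤min = p⊓q≤q (mult d) (minMult c ds)

minMult-glb : ∀ {q} c cs → All (λ d → q ≤ mult d) (c ∷ cs) → q ≤ minMult c cs
minMult-glb c []       (q≤c ∷ [])         = q≤c
minMult-glb c (d ∷ ds) (q≤c ∷ q≤d ∷ q≤ds) = ⊓-glb q≤d (minMult-glb c ds (q≤c ∷ q≤ds))

corollary4p7 : (T p : RTree) (c : RTree) (cs : List RTree)
    → (pT : p ⊑ T) (kp : node (c ∷ cs) ∈ children p)
    → ((1ℚ - inv (minMult c cs)) * ℕ→ℚ (degAt (step pT kp)) + 1ℚ + inv (minMult c cs))
      ≤ mult (node (c ∷ cs))
corollary4p7 T p c cs pT kp =
  mult-lowerBound (minMult-glb c cs (mults≥1 (c ∷ cs))) (minMult-≤ c cs)
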